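{- In any sequent of the form $\Gamma,@_{\mathsf{i}}\psi$ appearing in a play of the $\mathbf{Inf}$-game for a root formula $@_{\mathsf{r}}\rho$, the formula $\psi$ contains no non-original nominals.
   Context: Formulas of the hybrid $\mu$-calculus: $\varphi ::= p \mid \neg p \mid \mathsf{i} \mid \neg\mathsf{i} \mid \varphi\vee\varphi \mid \varphi\wedge\varphi \mid \Diamond\varphi \mid \Box\varphi \mid @_{\mathsf{i}}\varphi \mid \mu x.\varphi \mid \nu x.\varphi$ ($p,x$ propositional variables, $\mathsf{i}$ nominals; guarded, positive fixpoint variables; locally well-named). $\mathsf{i}\not\approx\mathsf{j}:=@_{\mathsf{i}}\neg\mathsf{j}$, $\mathsf{i}\approx\mathsf{j}:=@_{\mathsf{i}}\mathsf{j}$. $\mathbf{Inf}$: sequents are finite sets of formulas $@_{\mathsf{i}}\varphi$; axioms $\{@_{\mathsf{i}}p,@_{\mathsf{i}}\neg p\}$ ($p$ propositional variable or nominal) and $\{\mathsf{i}\approx\mathsf{i}\}$. Rules (premise(s)/conclusion): ($\wedge$) $\Gamma,@_{\mathsf{i}}(\varphi\wedge\psi),@_{\mathsf{i}}\varphi$ and $\Gamma,@_{\mathsf{i}}(\varphi\wedge\psi),@_{\mathsf{i}}\psi$ / $\Gamma,@_{\mathsf{i}}(\varphi\wedge\psi)$; ($\vee$) $\Gamma,@_{\mathsf{i}}(\varphi\vee\psi),@_{\mathsf{i}}\varphi,@_{\mathsf{i}}\psi$ / $\Gamma,@_{\mathsf{i}}(\varphi\vee\psi)$; ($\eta x$) $\Gamma,@_{\mathsf{i}}\eta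 x.\phi(x),@_{\mathsf{i}}\phi(\eta x.\phi(x))$ / $\Gamma,@_{\mathsf{i}}\eta x.\phi(x)$; ($\mathsf{Eq}$) $\Gamma,@_{\mathsf{i}}\phi,@_{\mathsf{j}}\phi,\mathsf{i}\not\approx\mathsf{j}$ / $\Gamma,@_{\mathsf{i}}\phi,\mathsf{i}\not\approx\mathsf{j}$ (principal $@_{\mathsf{i}}\phi$, side $\mathsf{i}\not\approx\mathsf{j}$); ($\mathsf{Com}$) $\Gamma,\mathsf{i}\not\approx\mathsf{j},\mathsf{j}\not\approx\mathsf{i}$ / $\Gamma,\mathsf{i}\not\approx\mathsf{j}$; ($\mathsf{Glob}$) $\Gamma,@_{\mathsf{i}}@_{\mathsf{j}}\varphi,@_{\mathsf{j}}\varphi$ / $\Gamma,@_{\mathsf{i}}@_{\mathsf{j}}\varphi$; ($\mathsf{Mod}$) $\Gamma,@_{\mathsf{i}}\Box\varphi,@_{\mathsf{i}}\Diamond\Psi,@_{\mathsf{j}}\varphi,@_{\mathsf{j}}\Psi$ / $\Gamma,@_{\mathsf{i}}\Box\varphi,@_{\mathsf{i}}\Diamond\Psi$ ($\Psi$ finite, $\mathsf{j}$ not in the conclusion, principal $@_{\mathsf{i}}\Box\varphi$); ($\mathsf{Weak}$) $\Gamma$ / $\Gamma\cup\Psi$. Repeating application: all premises equal the conclusion. The $\mathbf{Inf}$-game for $@_{\mathsf{r}}\rho$ ($\mathsf{r}$ not in $\rho$) starts at $\{@_{\mathsf{r}}\rho\}$. Original nominals are those occurring in $@_{\mathsf{r}}\rho$;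 ground formulas are $@_{\mathsf{j}}\psi$ with $\mathsf{j}$ original. Fix a strict linear order $\prec$ on formulas and, per formula, on rule instances with that principal formula. Narrow modal rule: $\mathsf{Mod}$ if the principal formula is ground; otherwise $\mathsf{Mod}$ followed by weakening away every $@_{\mathsf{k}}\psi$ with $\mathsf{k}$ non-original and distinct from the new nominal. Deterministic rule: if a non-repeating instance of $\wedge$, $\vee$, $\mathsf{Glob}$ or $\eta x$ applies, apply the one with $\prec$-least principal formula and least instance. Ground rule: apply the $\prec$-smallest applicable instance that is a non-repeating $\mathsf{Com}$ with principal $\mathsf{i}\not\approx\mathsf{j}$ for original $\mathsf{i},\mathsf{j}$, or a non-repeating $\mathsf{Eq}$ with principal $@_{\mathsf{j}}\varphi$, side $\mathsf{j}\not\approx\mathsf{i}$, $\mathsf{i}$ a $\prec$-minimal original nominal for which such an instance applies. Terminal weakening: weakening whose premise is an axiom. Positions: sequents (owned by $\mathbf{Ver}$) and pairs of sequents (owned by $\mathbf{Fal}$, who chooses one). At a sequent $\Gamma$: if an axiom, the game ends; else the deterministic rule if applicable is the only move; else the ground rule if applicable is the only move; else $\mathbf{Ver}$ chooses a narrow modal rule instance, a terminal weakening, or a repeating application of a non-modal rule. Moves lead to the premise (or the pair of premises of a two-premise rule). -}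

module Defs where

open import Data.Nat using (ℕ)
open import Data.Nat.Properties using () renaming (_≟_ to _≟ℕ_)
open import Data.List using (List; []; _∷_; _++_; map)
open import Data.List.Membership.Propositional using (_∈_; _∉_)
open import Data.List.Relation.Binary.Subset.Propositional using (_⊆_)
open import Data.List.Relation.Unary.All using (All)
open import Data.Product using (Σ; ∃; ∃-syntax; _×_; _,_; proj₁; proj₂)
open import Data.Sum using (_⊎_)
open import Data.Empty using (⊥)
open import Data.Unit using (⊤)
open import Relation.Nullary using (¬_; yes; no)
open import Relation.Binary.PropositionalEquality using (_≡_; _≢_)
open import Relation.Binary.Structures using (IsStrictPartialOrder)

-- Syntax of the hybrid μ-calculus.
-- Propositional variables (incl. fixpoint variables) and nominals are ℕ.

data FP : Set where
  μ ν : FP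

data Form : Set where
  prop  : ℕ → Form
  nprop : ℕ → Form
  nom   : ℕ → Form
  nnom  : ℕ → Form
  _∨'_  : Form → Form → Form
  _∧'_  : Form → Form → Form
  ◇     : Form → Form
  □     : Form → Form
  at    : ℕ → Form → Form
  fix   : FP → ℕ → Form → Form

noms : Form → List ℕ
noms (prop _)  = []
noms (nprop _) = []
noms (nom i)   = i ∷ []
noms (nnom i)  = i ∷ []
noms (φ ∨' ψ)  = noms φ ++ noms ψ
noms (φ ∧' ψ)  = noms φ ++ noms ψ
noms (◇ φ)     = noms φ
noms (□ φ)     = noms φ
noms (at i φ)  = i ∷ noms φ
noms (fix _ _ φ) = noms φ

sub : ℕ → Form → Form → Form
sub x ψ (prop y) with x ≟ℕ y
... | yes _ = ψ
... | no  _ = prop y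
sub x ψ (nprop y) = nprop y
sub x ψ (nom i)   = nom i
sub x ψ (nnom i)  = nnom i
sub x ψ (φ₁ ∨' φ₂) = sub x ψ φ₁ ∨' sub x ψ φ₂
sub x ψ (φ₁ ∧' φ₂) = sub x ψ φ₁ ∧' sub x ψ φ₂
sub x ψ (◇ φ) = ◇ (sub x ψ φ)
sub x ψ (□ φ) = □ (sub x ψ φ)
sub x ψ (at i φ) = at i (sub x ψ φ)
sub x ψ (fix η y φ) with x ≟ℕ y
... | yes _ = fix η y φ
... | no  _ = fix η y (sub x ψ φ)

-- Well-formedness: guarded, positive, locally well-named.

data Sub : Form → Form → Set where
  here : ∀ {φ} → Sub φ φ
  ∨l : ∀ {ψ φ₁ φ₂} → Sub ψ φ₁ → Sub ψ (φ₁ ∨' φ₂)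
  ∨r : ∀ {ψ φ₁ φ₂} → Sub ψ φ₂ → Sub ψ (φ₁ ∨' φ₂)
  ∧l : ∀ {ψ φ₁ φ₂} → Sub ψ φ₁ → Sub ψ (φ₁ ∧' φ₂)
  ∧r : ∀ {ψ φ₁ φ₂} → Sub ψ φ₂ → Sub ψ (φ₁ ∧' φ₂)
  ◇s : ∀ {ψ φ} → Sub ψ φ → Sub ψ (◇ φ)
  □s : ∀ {ψ φ} → Sub ψ φ → Sub ψ (□ φ)
  ats : ∀ {ψ i φ} → Sub ψ φ → Sub ψ (at i φ)
  fs : ∀ {ψ η x φ} → Sub ψ φ → Sub ψ (fix η x φ)

data Free (x : ℕ) : Form → Set where
  fp : Free x (prop x)
  fn : Free x (nprop x)
  ∨l : ∀ {φ₁ φ₂} → Free x φ₁ → Free x (φ₁ ∨' φ₂)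
  ∨r : ∀ {φ₁ φ₂} → Free x φ₂ → Free x (φ₁ ∨' φ₂)
  ∧l : ∀ {φ₁ φ₂} → Free x φ₁ → Free x (φ₁ ∧' φ₂)
  ∧r : ∀ {φ₁ φ₂} → Free x φ₂ → Free x (φ₁ ∧' φ₂)
  ◇s : ∀ {φ} → Free x φ → Free x (◇ φ)
  □s : ∀ {φ} → Free x φ → Free x (□ φ)
  ats : ∀ {i φ} → Free x φ → Free x (at i φ)
  fs : ∀ {η y φ} → x ≢ y → Free x φ → Free x (fix η y φ)

data NegFree (x : ℕ) : Form → Set where
  fn : NegFree x (nprop x)
  ∨l : ∀ {φ₁ φ₂} → NegFree x φ₁ → NegFree x (φ₁ ∨' φ₂)
  ∨r : ∀ {φ₁ φ₂} → NegFree x φ₂ → NegFree x (φ₁ ∨' φ₂)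
  ∧l : ∀ {φ₁ φ₂} → NegFree x φ₁ → NegFree x (φ₁ ∧' φ₂)
  ∧r : ∀ {φ₁ φ₂} → NegFree x φ₂ → NegFree x (φ₁ ∧' φ₂)
  ◇s : ∀ {φ} → NegFree x φ → NegFree x (◇ φ)
  □s : ∀ {φ} → NegFree x φ → NegFree x (□ φ)
  ats : ∀ {i φ} → NegFree x φ → NegFree x (at i φ)
  fs : ∀ {η y φ} → x ≢ y → NegFree x φ → NegFree x (fix η y φ)

data Unguarded (x : ℕ) : Form → Set where
  fp : Unguarded x (prop x)
  fn : Unguarded x (nprop x)
  ∨l : ∀ {φ₁ φ₂} → Unguarded x φ₁ → Unguarded x (φ₁ ∨' φ₂)
  ∨r : ∀ {φ₁ φ₂} → Unguarded x φ₂ → Unguarded x (φ₁ ∨' φ₂)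
  ∧l : ∀ {φ₁ φ₂} → Unguarded x φ₁ → Unguarded x (φ₁ ∧' φ₂)
  ∧r : ∀ {φ₁ φ₂} → Unguarded x φ₂ → Unguarded x (φ₁ ∧' φ₂)
  ats : ∀ {i φ} → Unguarded x φ → Unguarded x (at i φ)
  fs : ∀ {η y φ} → x ≢ y → Unguarded x φ → Unguarded x (fix η y φ)

Bound : ℕ → Form → Set
Bound x φ = ∃[ η ] ∃[ ψ ] Sub (fix η x ψ) φ

WellFormed : Form → Set
WellFormed ρ =
  (∀ η x φ → Sub (fix η x φ) ρ →
     ¬ Unguarded x φ × ¬ NegFree x φ × ¬ Bound x φ)
  × (∀ x → Free x ρ → ¬ Bound x ρ)

-- Sequents: finite sets of formulas @_i φ, represented as lists of
-- pairs (i , φ) under set semantics (only membership is ever used).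

SF : Set
SF = ℕ × Form

Seq : Set
Seq = List SF

_≐_ : Seq → Seq → Set
Γ ≐ Δ = Γ ⊆ Δ × Δ ⊆ Γ

_≉_ : ℕ → ℕ → SF
i ≉ j = i , nnom j

NomIn : ℕ → Seq → Set
NomIn j Γ = ∃[ x ] (x ∈ Γ × (j ≡ proj₁ x ⊎ j ∈ noms (proj₂ x)))

IsAxiom : Seq → Set
IsAxiom Γ =
  (∃[ i ] ∃[ p ] Γ ≐ ((i , prop p) ∷ (i , nprop p) ∷ []))
  ⊎ (∃[ i ] ∃[ j ] Γ ≐ ((i , nom j) ∷ (i , nnom j) ∷ []))
  ⊎ (∃[ i ] Γ ≐ ((i , nom i) ∷ []))

data Inst : Set where
  andR  : ℕ → Form → Form → Inst
  orR   : ℕ → Form → Form → Inst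
  fixR  : ℕ → FP → ℕ → Form → Inst
  eqR   : ℕ → ℕ → Form → Inst              -- principal @_i φ, side i≉j, adds @_j φ
  comR  : ℕ → ℕ → Inst                     -- principal i≉j, adds j≉i
  globR : ℕ → ℕ → Form → Inst              -- principal @_i@_j φ, adds @_j φ
  modR  : ℕ → Form → List Form → ℕ → Inst  -- principal @_i□φ, sides @_i◇Ψ, new j

principalSF : Inst → SF
principalSF (andR i φ ψ)   = i , (φ ∧' ψ)
principalSF (orR i φ ψ)    = i , (φ ∨' ψ)
principalSF (fixR i η x φ) = i , fix η x φ
principalSF (eqR i j φ)    = i , φ
principalSF (comR i j)     = i ≉ j
principalSF (globR i j φ)  = i , at j φ
principalSF (modR i φ Ψ j) = i , □ φ

principal : Inst → Form
principal I = at (proj₁ (principalSF I)) (proj₂ (principalSF I))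

needs : Inst → List SF
needs (eqR i j φ)    = (i , φ) ∷ (i ≉ j) ∷ []
needs (modR i φ Ψ j) = (i , □ φ) ∷ map (λ ψ → i , ◇ ψ) Ψ
needs I              = principalSF I ∷ []

-- formulas added in each premise (premise = conclusion ∪ additions)
adds : Inst → List (List SF)
adds (andR i φ ψ)   = ((i , φ) ∷ []) ∷ ((i , ψ) ∷ []) ∷ []
adds (orR i φ ψ)    = ((i , φ) ∷ (i , ψ) ∷ []) ∷ []
adds (fixR i η x φ) = ((i , sub x (fix η x φ) φ) ∷ []) ∷ []
adds (eqR i j φ)    = ((j , φ) ∷ []) ∷ []
adds (comR i j)     = ((j ≉ i) ∷ []) ∷ []
adds (globR i j φ)  = ((j , φ) ∷ []) ∷ []
adds (modR i φ Ψ j) = ((j , φ) ∷ map (λ ψ → j , ψ) Ψ) ∷ []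

sideCond : Seq → Inst → Set
sideCond Γ (modR i φ Ψ j) = ¬ NomIn j Γ
sideCond Γ _              = ⊤

Applicable : Seq → Inst → Set
Applicable Γ I = All (_∈ Γ) (needs I) × sideCond Γ I

premises : Seq → Inst → List Seq
premises Γ I = map (Γ ++_) (adds I)

-- repeating: every premise equals the conclusion
Repeating : Seq → Inst → Set
Repeating Γ I = All (λ A → A ⊆ Γ) (adds I)

IsDet : Inst → Set
IsDet (andR _ _ _)   = ⊤
IsDet (orR _ _ _)    = ⊤
IsDet (fixR _ _ _ _) = ⊤
IsDet (globR _ _ _)  = ⊤
IsDet _              = ⊥

IsModal : Inst → Set
IsModal (modR _ _ _ _) = ⊤
IsModal _              = ⊥

StrictLinear : {A : Set} → (A → A → Set) → Set
StrictLinear _<_ =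
  IsStrictPartialOrder _≡_ _<_ × (∀ x y → x ≢ y → x < y ⊎ y < x)

-- ≺ : strict linear order on formulas;
-- ⊏ : strict linear order on rule instances (inducing the order on the
--     instances sharing a principal formula)
record Orders : Set₁ where
  field
    _≺_ : Form → Form → Set
    ≺-linear : StrictLinear _≺_
    _⊏_ : Inst → Inst → Set
    ⊏-linear : StrictLinear _⊏_

module Game (r : ℕ) (ρ : Form) (O : Orders) where
  open Orders O

  Original : ℕ → Set
  Original k = k ≡ r ⊎ k ∈ noms ρ

  Ground : SF → Set
  Ground x = Original (proj₁ x)

  LeastAmong : (Inst → Set) → Inst → Set
  LeastAmong P I = P I × (∀ I' → P I' →
      I ≡ I' ⊎ principal I ≺ principal I'
      ⊎ (principal I ≡ principal I' × I ⊏ I'))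

  DetCand : Seq → Inst → Set
  DetCand Γ I = IsDet I × Applicable Γ I × ¬ Repeating Γ I

  DetApplies : Seq → Set
  DetApplies Γ = ∃[ I ] DetCand Γ I

  EqOK : Seq → ℕ → ℕ → Form → Set
  EqOK Γ j i φ = Applicable Γ (eqR j i φ) × ¬ Repeating Γ (eqR j i φ)

  EqTarget : Seq → ℕ → Set
  EqTarget Γ i = Original i × ∃[ j ] ∃[ φ ] EqOK Γ j i φ

  MinEqTarget : Seq → ℕ → Set
  MinEqTarget Γ i = EqTarget Γ i
    × (∀ i' → EqTarget Γ i' → i ≡ i' ⊎ nom i ≺ nom i')

  data GroundCand (Γ : Seq) : Inst → Set where
    com : ∀ {i j} → Original i → Original j →
          Applicable Γ (comR i j) → ¬ Repeating Γ (comR i j) →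
          GroundCand Γ (comR i j)
    eq  : ∀ {j i φ} → MinEqTarget Γ i → EqOK Γ j i φ →
          GroundCand Γ (eqR j i φ)

  GroundApplies : Seq → Set
  GroundApplies Γ = ∃[ I ] GroundCand Γ I

  NarrowPremise : Seq → Inst → Seq → Set
  NarrowPremise Γ (modR i φ Ψ j) Δ =
    (Original i × Δ ≡ Γ ++ ((j , φ) ∷ map (λ ψ → j , ψ) Ψ))
    ⊎ (¬ Original i × (∀ x → (x ∈ Δ →
          x ∈ Γ ++ ((j , φ) ∷ map (λ ψ → j , ψ) Ψ)
          × (Original (proj₁ x) ⊎ proj₁ x ≡ j))
        × (x ∈ Γ ++ ((j , φ) ∷ map (λ ψ → j , ψ) Ψ)
           → (Original (proj₁ x) ⊎ proj₁ x ≡ j) → x ∈ Δ)))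
  NarrowPremise Γ _ Δ = ⊥

  -- legal moves of Ver at a (non-axiomatic) sequent; the list gives the
  -- premise(s) (one sequent, or the pair handed to Fal)
  data Move (Γ : Seq) : List Seq → Set where
    det    : ∀ {I} → LeastAmong (DetCand Γ) I → Move Γ (premises Γ I)
    ground : ∀ {I} → ¬ DetApplies Γ → LeastAmong (GroundCand Γ) I →
             Move Γ (premises Γ I)
    modal  : ∀ {I Δ} → ¬ DetApplies Γ → ¬ GroundApplies Γ →
             IsModal I → Applicable Γ I → NarrowPremise Γ I Δ →
             Move Γ (Δ ∷ [])
    termWeak : ∀ {Δ} → ¬ DetApplies Γ → ¬ GroundApplies Γ →
             Δ ⊆ Γ → IsAxiom Δ → Move Γ (Δ ∷ [])
    repeatRule : ∀ {I} → ¬ DetApplies Γ → ¬ GroundApplies Γ →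
             ¬ IsModal I → Applicable Γ I → Repeating Γ I →
             Move Γ (premises Γ I)
    repeatWeak : ∀ {Δ} → ¬ DetApplies Γ → ¬ GroundApplies Γ →
             Δ ≐ Γ → Move Γ (Δ ∷ [])

  data InPlay : Seq → Set where
    start : InPlay ((r , ρ) ∷ [])
    step  : ∀ {Γ Δs Δ} → InPlay Γ → ¬ IsAxiom Γ → Move Γ Δs →
            Δ ∈ Δs → InPlay Δ

module Submission where

-- Call a nominal original if it is r or occurs in ρ.  We show
-- that every sequent reachable in the Inf-game for @_r ρ satisfies the
-- invariant "every nominal occurring in the body ψ of a formula @_i ψ of the
-- sequent is original".  The root {@_r ρ} satisfies it, and every move
-- preserves it, because a premise only ever adds formulas whose bodies are
-- built from bodies already present:
--   * ∧, ∨, Glob, Eq and Mod add (parts of) bodies of their principal and side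
--     formulas, and η x adds an unfolding φ[x := ηx.φ], whose nominals are
--     those of φ (substitution lemma below);
--   * Com is the one exception: from i ≉ j it adds @_j ¬i, moving the label i
--     into a body; in the game Com is only played as a ground rule (i original)
--     or as a repeating application (nothing new is added);
--   * weakenings, and the weakening part of the narrow modal rule, only
--     remove formulas.

open import Defs
open import Data.Nat using (ℕ)
open import Data.Nat.Properties using () renaming (_≟_ to _≟ℕ_)
open import Data.List using (_∷_; []; _++_; map)
open import Data.List.Membership.Propositional using (_∈_; _∉_)
open import Data.List.Membership.Propositional.Properties using (∈-++⁻; ∈-map⁻)
open import Data.List.Relation.Binary.Subset.Propositional using (_⊆_)
open import Data.List.Relation.Unary.Any using (here; there)
open import Data.List.Relation.Unary.All as All using (All; _∷_; [])
import Data.List.Relation.Unary.All.Properties as AllP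
open import Data.Product using (_,_; proj₁; _×_; ∃-syntax)
open import Data.Sum using (inj₁; inj₂)
open import Data.Unit using (⊤; tt)
open import Relation.Nullary using (yes; no)
open import Relation.Binary.PropositionalEquality using (refl)

sub-noms : ∀ {P : ℕ → Set} x {χ} φ →
           All P (noms χ) → All P (noms φ) → All P (noms (sub x χ φ))
sub-noms x (prop y) Pχ Pφ with x ≟ℕ y
... | yes _ = Pχ
... | no  _ = Pφ
sub-noms x (nprop y)   Pχ Pφ = Pφ
sub-noms x (nom i)     Pχ Pφ = Pφ
sub-noms x (nnom i)    Pχ Pφ = Pφ
sub-noms x (φ₁ ∨' φ₂) Pχ Pφ =
  AllP.++⁺ (sub-noms x φ₁ Pχ (AllP.++⁻ˡ (noms φ₁) Pφ))
           (sub-noms x φ₂ Pχ (AllP.++⁻ʳ (noms φ₁) Pφ))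
sub-noms x (φ₁ ∧' φ₂) Pχ Pφ =
  AllP.++⁺ (sub-noms x φ₁ Pχ (AllP.++⁻ˡ (noms φ₁) Pφ))
           (sub-noms x φ₂ Pχ (AllP.++⁻ʳ (noms φ₁) Pφ))
sub-noms x (◇ φ)       Pχ Pφ = sub-noms x φ Pχ Pφ
sub-noms x (□ φ)       Pχ Pφ = sub-noms x φ Pχ Pφ
sub-noms x (at i φ)    Pχ (Pi ∷ Pφ) = Pi ∷ sub-noms x φ Pχ Pφ
sub-noms x (fix η y φ) Pχ Pφ with x ≟ℕ y
... | yes _ = Pφ
... | no  _ = sub-noms x φ Pχ Pφ

BodyNoms : (ℕ → Set) → Seq → Set
BodyNoms P Γ = ∀ {i ψ} → (i , ψ) ∈ Γ → All P (noms ψ)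

module _ {P : ℕ → Set} where

  bodyNoms-⊆ : ∀ {Γ Δ} → Δ ⊆ Γ → BodyNoms P Γ → BodyNoms P Δ
  bodyNoms-⊆ Δ⊆Γ PΓ m = PΓ (Δ⊆Γ m)

  bodyNoms-++ : ∀ {Γ A} → BodyNoms P Γ → BodyNoms P A → BodyNoms P (Γ ++ A)
  bodyNoms-++ {Γ} PΓ PA m with ∈-++⁻ Γ m
  ... | inj₁ m∈Γ = PΓ m∈Γ
  ... | inj₂ m∈A = PA m∈A

  bodyNoms-[] : BodyNoms P []
  bodyNoms-[] ()

  bodyNoms-∷ : ∀ {i ψ A} → All P (noms ψ) → BodyNoms P A → BodyNoms P ((i , ψ) ∷ A)
  bodyNoms-∷ Pψ PA (here refl) = Pψ
  bodyNoms-∷ Pψ PA (there m)   = PA m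

  -- Com moves the label of its principal formula into a body; this is the
  -- additional requirement on that label.  No other rule needs anything.
  LabelOK : Inst → Set
  LabelOK (comR i j) = P i
  LabelOK _          = ⊤

  adds-bodyNoms : ∀ {Γ} I → Applicable Γ I → LabelOK I → BodyNoms P Γ →
                  ∀ {A} → A ∈ adds I → BodyNoms P A
  adds-bodyNoms (andR i φ ψ) (p ∷ _ , _) _ PΓ (here refl) =
    bodyNoms-∷ (AllP.++⁻ˡ (noms φ) (PΓ p)) bodyNoms-[]
  adds-bodyNoms (andR i φ ψ) (p ∷ _ , _) _ PΓ (there (here refl)) =
    bodyNoms-∷ (AllP.++⁻ʳ (noms φ) (PΓ p)) bodyNoms-[]
  adds-bodyNoms (orR i φ ψ) (p ∷ _ , _) _ PΓ (here refl) =
    bodyNoms-∷ (AllP.++⁻ˡ (noms φ) (PΓ p))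
      (bodyNoms-∷ (AllP.++⁻ʳ (noms φ) (PΓ p)) bodyNoms-[])
  adds-bodyNoms (fixR i η x φ) (p ∷ _ , _) _ PΓ (here refl) =
    bodyNoms-∷ (sub-noms x φ (PΓ p) (PΓ p)) bodyNoms-[]
  adds-bodyNoms (eqR i j φ) (p ∷ _ , _) _ PΓ (here refl) =
    bodyNoms-∷ (PΓ p) bodyNoms-[]
  adds-bodyNoms (comR i j) _ Pi PΓ (here refl) =
    bodyNoms-∷ (Pi ∷ []) bodyNoms-[]
  adds-bodyNoms (globR i j φ) (p ∷ _ , _) _ PΓ (here refl) =
    bodyNoms-∷ (All.tail (PΓ p)) bodyNoms-[]
  adds-bodyNoms (modR i φ Ψ j) (p ∷ ps , _) _ PΓ (here refl) =
    bodyNoms-∷ (PΓ p) sides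
    where
    -- each new @_j ψ comes from a side formula @_i ◇ψ of the conclusion
    sides : BodyNoms P (map (λ ψ → j , ψ) Ψ)
    sides m with ∈-map⁻ (λ ψ → j , ψ) m
    ... | ψ , ψ∈Ψ , refl = PΓ (All.lookup (AllP.map⁻ ps) ψ∈Ψ)

  premises-bodyNoms : ∀ {Γ} I → (∀ {A} → A ∈ adds I → BodyNoms P A) →
                      BodyNoms P Γ → ∀ {Δ} → Δ ∈ premises Γ I → BodyNoms P Δ
  premises-bodyNoms {Γ} I Padds PΓ m with ∈-map⁻ (Γ ++_) m
  ... | A , A∈adds , refl = bodyNoms-++ PΓ (Padds A∈adds)

  repeating-bodyNoms : ∀ {Γ} I → Repeating Γ I → BodyNoms P Γ →
                       ∀ {A} → A ∈ adds I → BodyNoms P A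
  repeating-bodyNoms I rep PΓ A∈adds = bodyNoms-⊆ (All.lookup rep A∈adds) PΓ

  det-labelOK : ∀ I → IsDet I → LabelOK I
  det-labelOK (andR _ _ _)   _ = tt
  det-labelOK (orR _ _ _)    _ = tt
  det-labelOK (fixR _ _ _ _) _ = tt
  det-labelOK (globR _ _ _)  _ = tt

module _ (r : ℕ) (ρ : Form) (O : Orders) where
  open Game r ρ O

  -- The narrow modal rule is Mod followed by a weakening: its premise is
  -- contained in the premise of the underlying Mod instance.
  narrow-⊆-premise : ∀ {Γ I Δ} → NarrowPremise Γ I Δ →
                     ∃[ Δ' ] (Δ' ∈ premises Γ I × Δ ⊆ Δ')
  narrow-⊆-premise {I = modR _ _ _ _} (inj₁ (_ , refl)) = _ , here refl , λ m → m
  narrow-⊆-premise {I = modR _ _ _ _} (inj₂ (_ , keep)) =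
    _ , here refl , λ m → proj₁ (proj₁ (keep _) m)

  ground-applicable : ∀ {Γ I} → GroundCand Γ I →
                      Applicable Γ I × LabelOK {Original} I
  ground-applicable (com oi _ ap _) = ap , oi
  ground-applicable (eq _ (ap , _)) = ap , tt

  move-bodyNoms : ∀ {Γ Δs Δ} → Move Γ Δs → BodyNoms Original Γ → Δ ∈ Δs →
                  BodyNoms Original Δ
  move-bodyNoms (det {I} ((isDet , ap , _) , _)) PΓ =
    premises-bodyNoms I (adds-bodyNoms I ap (det-labelOK I isDet) PΓ) PΓ
  move-bodyNoms (ground {I} _ (cand , _)) PΓ =
    let ap , ok = ground-applicable cand
    in premises-bodyNoms I (adds-bodyNoms I ap ok PΓ) PΓ
  move-bodyNoms (modal {modR i φ Ψ j} _ _ _ ap narrow) PΓ (here refl)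
    with narrow-⊆-premise narrow
  ... | Δ' , Δ'∈ , Δ⊆Δ' =
    bodyNoms-⊆ Δ⊆Δ' (premises-bodyNoms (modR i φ Ψ j)
                       (adds-bodyNoms (modR i φ Ψ j) ap tt PΓ) PΓ Δ'∈)
  move-bodyNoms (termWeak _ _ Δ⊆Γ _) PΓ (here refl) = bodyNoms-⊆ Δ⊆Γ PΓ
  move-bodyNoms (repeatRule {I} _ _ _ _ rep) PΓ =
    premises-bodyNoms I (repeating-bodyNoms I rep PΓ) PΓ
  move-bodyNoms (repeatWeak _ _ (Δ⊆Γ , _)) PΓ (here refl) = bodyNoms-⊆ Δ⊆Γ PΓ

  inPlay-bodyNoms : ∀ {Γ} → InPlay Γ → BodyNoms Original Γ
  inPlay-bodyNoms start = bodyNoms-∷ (All.tabulate inj₂) bodyNoms-[]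
  inPlay-bodyNoms (step play _ move Δ∈) = move-bodyNoms move (inPlay-bodyNoms play) Δ∈

mainTheorem5 : (r : ℕ) (ρ : Form) → r ∉ noms ρ → WellFormed ρ →
    (O : Orders) → (Γ : Seq) → Game.InPlay r ρ O Γ →
    ∀ i ψ → (i , ψ) ∈ Γ → ∀ k → k ∈ noms ψ → Game.Original r ρ O k
mainTheorem5 r ρ _ _ O Γ play i ψ ψ∈Γ k k∈ψ =
  All.lookup (inPlay-bodyNoms r ρ O play ψ∈Γ) k∈ψ
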